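{- Let $r \geq 3$ and $k \geq 1$ be integers and let $G$ be a graph on $n$ vertices with $\delta(G) \geq \lfloor n/2 \rfloor + k$. Then every set $A \subseteq V(G)$ with $|A| \geq \lceil n/2 \rceil + (r-k-1)$ satisfies $\langle A \rangle_r = V(G)$.
   Context: Graphs are finite and simple; $\delta(G)$ is the minimum degree and $N(v)$ the neighbourhood of $v$. For an integer $r \geq 2$, the $r$-neighbour bootstrap process on $G$ started from $A \subseteq V(G)$ is defined by $A_0 = A$ and $A_t = A_{t-1} \cup \{v \in V(G) : |N(v) \cap A_{t-1}| \geq r\}$ for $t \geq 1$. The closure is $\langle A \rangle_r = \bigcup_{t \geq 0} A_t$. -}

module Defs where

open import Data.Nat using (ℕ; zero; suc; _+_; _∸_; _≤_; _/_; ⌊_/2⌋; ⌈_/2⌉)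
open import Data.Bool using (Bool; true; false; _∧_; _∨_; if_then_else_)
open import Data.Fin using (Fin)
open import Data.Vec.Functional using (Vector; foldr)
open import Data.Product using (∃; _×_)
open import Relation.Binary.PropositionalEquality using (_≡_)

record Graph (n : ℕ) : Set where
  field
    adj   : Fin n → Fin n → Bool
    sym   : ∀ u v → adj u v ≡ adj v u
    irrefl : ∀ v → adj v v ≡ false
open Graph public

count : ∀ {n} → (Fin n → Bool) → ℕ
count {n} p = foldr (λ b acc → (if b then 1 else 0) + acc) 0 p

VSet : ℕ → Set
VSet n = Fin n → Bool

size : ∀ {n} → VSet n → ℕ
size = count

degree : ∀ {n} → Graph n → Fin n → ℕ
degree G v = count (adj G v)

nbrsIn : ∀ {n} → Graph n → VSet n → Fin n → ℕ
nbrsIn G A v = count (λ u → adj G v u ∧ A u)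

MinDegreeAtLeast : ∀ {n} → Graph n → ℕ → Set
MinDegreeAtLeast G d = ∀ v → d ≤ degree G v

_≤ᵇ_ : ℕ → ℕ → Bool
zero ≤ᵇ _ = true
suc m ≤ᵇ zero = false
suc m ≤ᵇ suc n = m ≤ᵇ n

step : ∀ {n} → ℕ → Graph n → VSet n → VSet n
step r G A v = A v ∨ (r ≤ᵇ nbrsIn G A v)

bootstrap : ∀ {n} → ℕ → Graph n → VSet n → ℕ → VSet n
bootstrap r G A zero = A
bootstrap r G A (suc t) = step r G (bootstrap r G A t)

InClosure : ∀ {n} → ℕ → Graph n → VSet n → Fin n → Set
InClosure r G A v = ∃ λ t → bootstrap r G A t v ≡ true

Percolates : ∀ {n} → ℕ → Graph n → VSet n → Set
Percolates r G A = ∀ v → InClosure r G A v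

-- A vertex v outside A has at least δ(G) + |A| − (n − 1) neighbours in A, because
-- N(v) ∪ A misses v. Under the hypotheses this lower bound is already at least r,
-- so every vertex is infected in the first round.
module Submission where

open import Defs
open import Data.Nat using (ℕ; zero; suc; _+_; _≤_; _<_; z≤n; s≤s; ⌊_/2⌋; ⌈_/2⌉)
open import Data.Nat.Properties
  using (+-cancelˡ-≤; +-mono-≤; +-monoˡ-≤; +-monoʳ-<; m≤n⇒m≤1+n; ⌊n/2⌋+⌈n/2⌉≡n; module ≤-Reasoning)
open import Data.Nat.Tactic.RingSolver using (solve-∀)
open import Data.Bool using (Bool; true; false; _∧_; _∨_; if_then_else_)
open import Data.Fin using (Fin)
import Data.Fin as Fin
open import Data.Vec.Functional using (tail)
open import Data.Product using (_,_)
open import Relation.Binary.PropositionalEquality using (_≡_; refl; cong; cong₂; module ≡-Reasoning)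

indicator : Bool → ℕ
indicator b = if b then 1 else 0

indicator-∧-∨ : ∀ a b → indicator a + indicator b ≡ indicator (a ∧ b) + indicator (a ∨ b)
indicator-∧-∨ true  true  = refl
indicator-∧-∨ true  false = refl
indicator-∧-∨ false true  = refl
indicator-∧-∨ false false = refl

count-∧-∨ : ∀ {n} (p q : Fin n → Bool) →
            count p + count q ≡ count (λ i → p i ∧ q i) + count (λ i → p i ∨ q i)
count-∧-∨ {zero}  p q = refl
count-∧-∨ {suc n} p q = begin
  (a + P) + (b + Q)         ≡⟨ interchange a P b Q ⟩
  (a + b) + (P + Q)         ≡⟨ cong₂ _+_ (indicator-∧-∨ (p Fin.zero) (q Fin.zero)) (count-∧-∨ (tail p) (tail q)) ⟩
  (a∧b + a∨b) + (P∧Q + P∨Q) ≡⟨ interchange a∧b a∨b P∧Q P∨Q ⟩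
  (a∧b + P∧Q) + (a∨b + P∨Q) ∎
  where
  open ≡-Reasoning
  interchange : ∀ w x y z → (w + x) + (y + z) ≡ (w + y) + (x + z)
  interchange = solve-∀
  a b a∧b a∨b P Q P∧Q P∨Q : ℕ
  a = indicator (p Fin.zero)
  b = indicator (q Fin.zero)
  a∧b = indicator (p Fin.zero ∧ q Fin.zero)
  a∨b = indicator (p Fin.zero ∨ q Fin.zero)
  P = count (tail p)
  Q = count (tail q)
  P∧Q = count (λ i → tail p i ∧ tail q i)
  P∨Q = count (λ i → tail p i ∨ tail q i)

count≤ : ∀ {n} (p : Fin n → Bool) → count p ≤ n
count≤ {zero}  p = z≤n
count≤ {suc n} p with p Fin.zero
... | true  = s≤s (count≤ (tail p))
... | false = m≤n⇒m≤1+n (count≤ (tail p))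

count< : ∀ {n} (p : Fin n → Bool) (i : Fin n) → p i ≡ false → count p < n
count< {suc n} p Fin.zero    pi≡false rewrite pi≡false = s≤s (count≤ (tail p))
count< {suc n} p (Fin.suc i) pi≡false with p Fin.zero
... | true  = s≤s (count< (tail p) i pi≡false)
... | false = m≤n⇒m≤1+n (count< (tail p) i pi≡false)

≤⇒≤ᵇ : ∀ {m n} → m ≤ n → (m ≤ᵇ n) ≡ true
≤⇒≤ᵇ z≤n       = refl
≤⇒≤ᵇ (s≤s m≤n) = ≤⇒≤ᵇ m≤n

degree+size<nbrsIn+n : ∀ {n} (G : Graph n) (A : VSet n) (v : Fin n) → A v ≡ false →
                       degree G v + size A < nbrsIn G A v + n
degree+size<nbrsIn+n {n} G A v v∉A = begin-strict
  degree G v + size A            ≡⟨ count-∧-∨ (adj G v) A ⟩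
  nbrsIn G A v + count N[v]∪A   <⟨ +-monoʳ-< (nbrsIn G A v) (count< N[v]∪A v v∉N[v]∪A) ⟩
  nbrsIn G A v + n               ∎
  where
  open ≤-Reasoning
  N[v]∪A : VSet n
  N[v]∪A u = adj G v u ∨ A u
  v∉N[v]∪A : N[v]∪A v ≡ false
  v∉N[v]∪A = cong₂ _∨_ (irrefl G v) v∉A

percolates-in-one-round : ∀ {n} r (G : Graph n) (A : VSet n) →
                          (∀ v → A v ≡ false → r ≤ nbrsIn G A v) → Percolates r G A
percolates-in-one-round r G A outside-has-r v = 1 , infected
  where
  infected : (A v ∨ (r ≤ᵇ nbrsIn G A v)) ≡ true
  infected with A v in v∈A
  ... | true  = refl
  ... | false = ≤⇒≤ᵇ (outside-has-r v v∈A)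

lemma3p1 : (r k n : ℕ) → 3 ≤ r → 1 ≤ k → (G : Graph n)
    → MinDegreeAtLeast G (⌊ n /2⌋ + k)
    → (A : VSet n) → ⌈ n /2⌉ + r ≤ size A + k + 1
    → Percolates r G A
lemma3p1 r k n _ _ G δ≥ A |A|≥ = percolates-in-one-round r G A r≤nbrsIn
  where
  open ≤-Reasoning
  regroup₁ : ∀ f c k r → f + c + k + r ≡ (f + k) + (c + r)
  regroup₁ = solve-∀
  regroup₂ : ∀ d s k → d + (s + k + 1) ≡ suc (d + s) + k
  regroup₂ = solve-∀
  regroup₃ : ∀ x n k → x + n + k ≡ n + k + x
  regroup₃ = solve-∀
  r≤nbrsIn : ∀ v → A v ≡ false → r ≤ nbrsIn G A v
  r≤nbrsIn v v∉A = +-cancelˡ-≤ (n + k) r (nbrsIn G A v) (begin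
    n + k + r                                 ≡⟨ cong (λ m → m + k + r) (⌊n/2⌋+⌈n/2⌉≡n n) ⟨
    ⌊ n /2⌋ + ⌈ n /2⌉ + k + r                 ≡⟨ regroup₁ ⌊ n /2⌋ ⌈ n /2⌉ k r ⟩
    (⌊ n /2⌋ + k) + (⌈ n /2⌉ + r)             ≤⟨ +-mono-≤ (δ≥ v) |A|≥ ⟩
    degree G v + (size A + k + 1)             ≡⟨ regroup₂ (degree G v) (size A) k ⟩
    suc (degree G v + size A) + k             ≤⟨ +-monoˡ-≤ k (degree+size<nbrsIn+n G A v v∉A) ⟩
    nbrsIn G A v + n + k                      ≡⟨ regroup₃ (nbrsIn G A v) n k ⟩
    n + k + nbrsIn G A v                      ∎)
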